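{- Let $(M,\mathcal{X})$, $\mathcal{X}=(X_a)_{a\in V(M)}$, be a median decomposition of a graph $G$. For every edge $ab$ of $M$, the set $Z_{ab}\cap Z_{ba}$ separates $Y_{ab}$ from $Y_{ba}$ in $G$, i.e. every path in $G$ from a vertex of $Y_{ab}$ to a vertex of $Y_{ba}$ contains a vertex of $Z_{ab}\cap Z_{ba}$.
   Context: All graphs are finite, simple and undirected. For vertices $u,v$ of a connected graph, $I(u,v)$ is the set of vertices on shortest $(u,v)$-paths; a vertex set $S$ is convex if $I(u,v)\subseteq S$ for all $u,v\in S$. A median graph is a connected graph $M$ with $|I(u,v)\cap I(v,w)\cap I(w,u)|=1$ for all vertices $u,v,w$. A median decomposition of $G$ is a pair $(M,\mathcal{X})$ with $M$ a median graph and $\mathcal{X}=(X_a)_{a\in V(M)}$ subsets of $V(G)$ such that (M1) every edge of $G$ has both ends in some $X_a$, and (M2) for every $v\in V(G)$, $X^{ -1}(v)=\{a: v\in X_a\}$ is non-empty and convex in $M$. For an edge $ab$ of $M$: $W_{ab}=\{v\in V(M): d(v,a)<d(v,b)\}$, $U_{ab}=W_{ab}\cap N_M(W_{ba})$ (vertices of $W_{ab}$ having a neighbour in $W_{ba}$), $Y_{ab}=\bigcup_{x\in W_{ab}}X_x$ and $Z_{ab}=\bigcup_{x\in U_{ab}}X_x$. -}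

module Defs where

open import Data.Nat using (ℕ; zero; suc; _+_; _<_)
open import Data.Fin using (Fin)
open import Data.List using (List; []; _∷_)
open import Data.List.Membership.Propositional using (_∈_)
open import Data.List.Relation.Unary.Unique.Propositional using (Unique)
open import Data.List.Relation.Unary.Any using (Any)
open import Data.Product using (Σ; ∃; ∃-syntax; _×_; _,_)
open import Relation.Binary.PropositionalEquality using (_≡_)
open import Relation.Nullary using (¬_)

record Graph : Set₁ where
  field
    n     : ℕ
    Adj   : Fin n → Fin n → Set
    sym   : ∀ {u v} → Adj u v → Adj v u
    irrefl : ∀ {u} → ¬ Adj u u

module _ (G : Graph) where
  open Graph G

  V : Set
  V = Fin n

  data Walk : V → V → Set where
    [_]  : (u : V) → Walk u u
    _∷⟨_⟩_ : (u : V) {v w : V} → Adj u v → Walk v w → Walk u w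

  len : ∀ {u v} → Walk u v → ℕ
  len [ _ ] = 0
  len (_ ∷⟨ _ ⟩ p) = suc (len p)

  verts : ∀ {u v} → Walk u v → List V
  verts [ u ] = u ∷ []
  verts (u ∷⟨ _ ⟩ p) = u ∷ verts p

  IsPath : ∀ {u v} → Walk u v → Set
  IsPath p = Unique (verts p)

  Connected : Set
  Connected = (u v : V) → Walk u v

  Dist : V → V → ℕ → Set
  Dist u v k = (Σ (Walk u v) λ p → len p ≡ k) × (∀ (p : Walk u v) → ¬ (len p < k))

  Interval : V → V → V → Set
  Interval u v x = Σ (Walk u v) λ p → Dist u v (len p) × x ∈ verts p

  Convex : (V → Set) → Set
  Convex S = ∀ u v x → S u → S v → Interval u v x → S x

record MedianGraph : Set₁ where
  field
    graph     : Graph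
    connected : Connected graph
    median    : ∀ u v w → Σ (V graph) λ m →
                  (Interval graph u v m × Interval graph v w m × Interval graph w u m)
                  × (∀ m' → Interval graph u v m' → Interval graph v w m' → Interval graph w u m' → m' ≡ m)

record MedianDecomposition (G : Graph) (M : MedianGraph) : Set₁ where
  open MedianGraph M
  field
    X  : V graph → V G → Set
    M1 : ∀ {u v} → Graph.Adj G u v → ∃[ a ] (X a u × X a v)
    M2-nonempty : ∀ v → ∃[ a ] X a v
    M2-convex   : ∀ v → Convex graph (λ a → X a v)

module _ {G : Graph} {M : MedianGraph} (D : MedianDecomposition G M) where
  open MedianGraph M
  open MedianDecomposition D

  W : V graph → V graph → V graph → Set
  W a b v = ∃[ k ] ∃[ l ] (Dist graph v a k × Dist graph v b l × k < l)

  U : V graph → V graph → V graph → Set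
  U a b x = W a b x × ∃[ y ] (Graph.Adj graph x y × W b a y)

  Y : V graph → V graph → V G → Set
  Y a b v = ∃[ x ] (W a b x × X x v)

  Z : V graph → V graph → V G → Set
  Z a b v = ∃[ x ] (U a b x × X x v)

-- The sides W_ab, W_ba of an edge ab partition M: the median of a, b and c lies in
-- I(a,b) = {a,b}, and it is a or b according to the side containing c.  A vertex w of G
-- lying in Y_ab and in Y_ba has bags on both sides; X⁻¹(w) is convex, so it contains a
-- geodesic between them, and that geodesic crosses from W_ab to W_ba along an edge xy with
-- x ∈ U_ab, y ∈ U_ba, both bags containing w; hence w ∈ Z_ab ∩ Z_ba.  Walking along a path
-- of G from Y_ab, each edge lies in some bag X_c: if c ∈ W_ab the next vertex is again in
-- Y_ab, and if c ∈ W_ba the current vertex is in Y_ab ∩ Y_ba.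
module Submission where

open import Defs
open import Data.Empty using (⊥-elim)
open import Data.List.Membership.Propositional using (_∈_)
open import Data.List.Relation.Unary.Any using (Any; here; there)
open import Data.Nat using (suc; _+_; _<_; _≤_; s≤s; z≤n)
open import Data.Nat.Properties
  using (≤-trans; ≤-reflexive; ≤-antisym; ≮⇒≥; <-asym; m<m+n; m<n+m; module ≤-Reasoning)
open import Data.Product using (Σ; ∃-syntax; _×_; _,_)
open import Data.Sum using (_⊎_; inj₁; inj₂)
open import Relation.Binary.PropositionalEquality using (_≡_; refl; trans; cong)
open import Relation.Nullary using (¬_)

Closer : (H : Graph) → V H → V H → V H → Set
Closer H a b v = ∃[ k ] ∃[ l ] (Dist H v a k × Dist H v b l × k < l)

module WalkProperties (H : Graph) where
  open Graph H renaming (sym to adj-sym)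

  _∷ʳ⟨_⟩ : ∀ {u v w} → Walk H u v → Adj v w → Walk H u w
  [ u ] ∷ʳ⟨ e ⟩ = u ∷⟨ e ⟩ [ _ ]
  (u ∷⟨ e′ ⟩ p) ∷ʳ⟨ e ⟩ = u ∷⟨ e′ ⟩ (p ∷ʳ⟨ e ⟩)

  len-∷ʳ : ∀ {u v w} (p : Walk H u v) (e : Adj v w) → len H (p ∷ʳ⟨ e ⟩) ≡ suc (len H p)
  len-∷ʳ [ u ] e = refl
  len-∷ʳ (u ∷⟨ e′ ⟩ p) e = cong suc (len-∷ʳ p e)

  reverse : ∀ {u v} → Walk H u v → Walk H v u
  reverse [ u ] = [ u ]
  reverse (u ∷⟨ e ⟩ p) = reverse p ∷ʳ⟨ adj-sym e ⟩

  len-reverse : ∀ {u v} (p : Walk H u v) → len H (reverse p) ≡ len H p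
  len-reverse [ u ] = refl
  len-reverse (u ∷⟨ e ⟩ p) = trans (len-∷ʳ (reverse p) (adj-sym e)) (cong suc (len-reverse p))

  splitAt : ∀ {u v x} (p : Walk H u v) → x ∈ verts H p →
            Σ (Walk H u x) λ p₁ → Σ (Walk H x v) λ p₂ → len H p₁ + len H p₂ ≡ len H p
  splitAt [ u ] (here refl) = [ u ] , [ u ] , refl
  splitAt (u ∷⟨ e ⟩ p) (here refl) = [ u ] , (u ∷⟨ e ⟩ p) , refl
  splitAt (u ∷⟨ e ⟩ p) (there x∈p) with splitAt p x∈p
  ... | p₁ , p₂ , eq = (u ∷⟨ e ⟩ p₁) , p₂ , cong suc eq

  head∈verts : ∀ {u v} (p : Walk H u v) → u ∈ verts H p
  head∈verts [ _ ] = here refl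
  head∈verts (_ ∷⟨ _ ⟩ _) = here refl

  1≤len-of-adjacent : ∀ {u v} → Adj u v → (p : Walk H u v) → 1 ≤ len H p
  1≤len-of-adjacent e [ u ] = ⊥-elim (irrefl e)
  1≤len-of-adjacent e (u ∷⟨ _ ⟩ p) = s≤s z≤n

  dist-≤-len : ∀ {u v k} → Dist H u v k → (p : Walk H u v) → k ≤ len H p
  dist-≤-len (_ , minimal) p = ≮⇒≥ (minimal p)

  dist-≤-len-reverse : ∀ {u v k} → Dist H u v k → (p : Walk H v u) → k ≤ len H p
  dist-≤-len-reverse d p = ≤-trans (dist-≤-len d (reverse p)) (≤-reflexive (len-reverse p))

  dist-unique : ∀ {u v k l} → Dist H u v k → Dist H u v l → k ≡ l
  dist-unique dk@((p , refl) , _) dl@((q , refl) , _) = ≤-antisym (dist-≤-len dk q) (dist-≤-len dl p)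

  interval-of-edge : ∀ {a b m} → Adj a b → Interval H a b m → m ≡ a ⊎ m ≡ b
  interval-of-edge e ([ _ ] , _ , _) = ⊥-elim (irrefl e)
  interval-of-edge e (_ ∷⟨ _ ⟩ [ _ ] , _ , here refl) = inj₁ refl
  interval-of-edge e (_ ∷⟨ _ ⟩ [ _ ] , _ , there (here refl)) = inj₂ refl
  interval-of-edge e (_ ∷⟨ _ ⟩ [ _ ] , _ , there (there ()))
  interval-of-edge {a} {b} e (_ ∷⟨ _ ⟩ (_ ∷⟨ _ ⟩ _) , (_ , minimal) , _) =
    ⊥-elim (minimal (a ∷⟨ e ⟩ [ b ]) (s≤s (s≤s z≤n)))

  on-geodesic-from⇒closer : ∀ {a b c k l} → Adj a b → Interval H b c a →
                            Dist H c a k → Dist H c b l → k < l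
  on-geodesic-from⇒closer e (q , dq , a∈q) dca dcb@((cb , refl) , _) with splitAt q a∈q
  ... | p₁ , p₂ , eq = begin-strict
    _                      ≤⟨ dist-≤-len-reverse dca p₂ ⟩
    len H p₂               <⟨ m<n+m (len H p₂) (1≤len-of-adjacent (adj-sym e) p₁) ⟩
    len H p₁ + len H p₂    ≡⟨ eq ⟩
    len H q                ≤⟨ dist-≤-len-reverse dq cb ⟩
    len H cb               ∎
    where open ≤-Reasoning

  on-geodesic-to⇒closer : ∀ {a b c k l} → Adj a b → Interval H c b a →
                          Dist H c a k → Dist H c b l → k < l
  on-geodesic-to⇒closer e (q , dq , a∈q) dca dcb with splitAt q a∈q
  ... | p₁ , p₂ , eq = begin-strict
    _                      ≤⟨ dist-≤-len dca p₁ ⟩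
    len H p₁               <⟨ m<m+n (len H p₁) (1≤len-of-adjacent e p₂) ⟩
    len H p₁ + len H p₂    ≡⟨ eq ⟩
    len H q                ≡⟨ dist-unique dq dcb ⟩
    _                      ∎
    where open ≤-Reasoning

  closer-asym : ∀ {a b c} → Closer H a b c → ¬ Closer H b a c
  closer-asym (k , l , dca , dcb , k<l) (l′ , k′ , dcb′ , dca′ , l′<k′)
    rewrite dist-unique dca dca′ | dist-unique dcb dcb′ = <-asym k<l l′<k′

  walk-crosses : {A B : V H → Set} → (∀ c → A c ⊎ B c) → (∀ {c} → A c → ¬ B c) →
                 ∀ {s t} (r : Walk H s t) → A s → B t →
                 ∃[ x ] ∃[ y ] (Adj x y × x ∈ verts H r × y ∈ verts H r × A x × B y)
  walk-crosses split disjoint [ s ] As Bs = ⊥-elim (disjoint As Bs)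
  walk-crosses split disjoint (_∷⟨_⟩_ s {v} e r) As Bt with split v
  ... | inj₂ Bv = s , v , e , here refl , there (head∈verts r) , As , Bv
  ... | inj₁ Av with walk-crosses split disjoint r Av Bt
  ...   | x , y , exy , x∈r , y∈r , Ax , By = x , y , exy , there x∈r , there y∈r , Ax , By

module MedianGraphProperties (M : MedianGraph) where
  open MedianGraph M
  open Graph graph renaming (sym to adj-sym)
  open WalkProperties graph

  -- Connectedness gives no shortest walk constructively; the median of x, y, y comes with one.
  geodesic : ∀ x y → Σ (Walk graph x y) λ p → Dist graph x y (len graph p)
  geodesic x y with median x y y
  ... | _ , ((p , d , _) , _) , _ = p , d

  closer-intro : ∀ {a b c} → (∀ {k l} → Dist graph c a k → Dist graph c b l → k < l) → Closer graph a b c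
  closer-intro {a} {b} {c} k<l with geodesic c a | geodesic c b
  ... | ca , dca | cb , dcb = len graph ca , len graph cb , dca , dcb , k<l dca dcb

  closer-or-closer : ∀ {a b} → Adj a b → ∀ c → Closer graph a b c ⊎ Closer graph b a c
  closer-or-closer {a} {b} e c with median a b c
  ... | m , (m∈ab , m∈bc , m∈ca) , _ with interval-of-edge e m∈ab
  ... | inj₁ refl = inj₁ (closer-intro (on-geodesic-from⇒closer e m∈bc))
  ... | inj₂ refl = inj₂ (closer-intro (on-geodesic-to⇒closer (adj-sym e) m∈ca))

module Separation {G : Graph} {M : MedianGraph} (D : MedianDecomposition G M) where
  open MedianGraph M
  open MedianDecomposition D
  open Graph graph renaming (sym to adj-sym)
  open WalkProperties graph
  open MedianGraphProperties M

  Y∩Y⊆Z∩Z : ∀ {a b} → Adj a b → ∀ {w} → Y D a b w → Y D b a w → Z D a b w × Z D b a w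
  Y∩Y⊆Z∩Z e {w} (x , x∈Wab , w∈Xx) (y , y∈Wba , w∈Xy)
    with geodesic x y
  ... | p , dp with walk-crosses (closer-or-closer e) closer-asym p x∈Wab y∈Wba
  ... | x′ , y′ , e′ , x′∈p , y′∈p , x′∈Wab , y′∈Wba =
    (x′ , (x′∈Wab , y′ , e′ , y′∈Wba) , w∈X x′∈p) , (y′ , (y′∈Wba , x′ , adj-sym e′ , x′∈Wab) , w∈X y′∈p)
    where
      w∈X : ∀ {z} → z ∈ verts graph p → X z w
      w∈X z∈p = M2-convex w x y _ w∈Xx w∈Xy (p , dp , z∈p)

  walk-meets-Z∩Z : ∀ {a b} → Adj a b → ∀ {u v} → Y D a b u → Y D b a v →
                   (p : Walk G u v) → Any (λ z → Z D a b z × Z D b a z) (verts G p)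
  walk-meets-Z∩Z e u∈Yab v∈Yba [ u ] = here (Y∩Y⊆Z∩Z e u∈Yab v∈Yba)
  walk-meets-Z∩Z e u∈Yab v∈Yba (u ∷⟨ uu′ ⟩ p) with M1 uu′
  ... | c , u∈Xc , u′∈Xc with closer-or-closer e c
  ... | inj₁ c∈Wab = there (walk-meets-Z∩Z e (c , c∈Wab , u′∈Xc) v∈Yba p)
  ... | inj₂ c∈Wba = here (Y∩Y⊆Z∩Z e u∈Yab (c , c∈Wba , u∈Xc))

lemma3p5 : (G : Graph) (M : MedianGraph) (D : MedianDecomposition G M)
    → ∀ {a b} → Graph.Adj (MedianGraph.graph M) a b
    → ∀ {u v} → Y D a b u → Y D b a v
    → (p : Walk G u v) → IsPath G p
    → Any (λ z → Z D a b z × Z D b a z) (verts G p)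
lemma3p5 G M D e u∈Yab v∈Yba p _ = Separation.walk-meets-Z∩Z D e u∈Yab v∈Yba p
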